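{- For every odd integer $n\ge 3$, the cycle $C_n$ on $n$ vertices satisfies $C_2(C_n)=3$.
   Context: All graphs are finite, simple and undirected. A set $S\subseteq V(G)$ is a $2$-dominating set of $G$ if every vertex of $V(G)\setminus S$ has at least $2$ neighbours in $S$. Two sets $U_1,U_2\subseteq V(G)$ form a $2$-coalition if neither $U_1$ nor $U_2$ is a $2$-dominating set of $G$, but $U_1\cup U_2$ is. A $2$-coalition partition of $G$ is a partition $\Theta$ of $V(G)$ into nonempty sets such that every set of $\Theta$ either is a $2$-dominating set of $G$ with exactly $2$ elements, or forms a $2$-coalition with some other set of $\Theta$. The $2$-coalition number $C_2(G)$ is the maximum number of sets in a $2$-coalition partition of $G$. -}

module Defs where

open import Data.Nat using (ℕ; zero; suc; _≤_)
open import Data.Fin using (Fin; toℕ; _≟_)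
open import Data.Fin.Subset using (Subset; _∈_; _∉_; _∪_; ∣_∣)
open import Data.Vec using (tabulate)
open import Data.Product using (Σ; ∃; _×_)
open import Data.Sum using (_⊎_)
open import Relation.Nullary using (¬_)
open import Relation.Nullary.Decidable using (isYes)
open import Relation.Binary.PropositionalEquality using (_≡_; _≢_)

record Graph (n : ℕ) : Set₁ where
  field
    Adj     : Fin n → Fin n → Set
    irrefl  : ∀ v → ¬ Adj v v
    sym     : ∀ u v → Adj u v → Adj v u
open Graph public

cycleAdj : (n : ℕ) → Fin n → Fin n → Set
cycleAdj n i j =
    (toℕ j ≡ suc (toℕ i)) ⊎ (toℕ i ≡ suc (toℕ j))
  ⊎ (toℕ i ≡ 0 × suc (toℕ j) ≡ n) ⊎ (toℕ j ≡ 0 × suc (toℕ i) ≡ n)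

module _ {n : ℕ} (G : Graph n) where

  TwoDominating : Subset n → Set
  TwoDominating S = ∀ v → v ∉ S →
    Σ (Fin n) λ u → Σ (Fin n) λ w →
      u ≢ w × u ∈ S × w ∈ S × Adj G v u × Adj G v w

  TwoCoalition : Subset n → Subset n → Set
  TwoCoalition U₁ U₂ =
    ¬ TwoDominating U₁ × ¬ TwoDominating U₂ × TwoDominating (U₁ ∪ U₂)

  block : {k : ℕ} → (Fin n → Fin k) → Fin k → Subset n
  block f i = tabulate (λ v → isYes (f v ≟ i))

  -- f : Fin n → Fin k describes a partition of V(G) into k labelled blocks
  -- (block i = f⁻¹(i)); surjectivity = all blocks nonempty.
  IsTwoCoalitionPartition : {k : ℕ} → (Fin n → Fin k) → Set
  IsTwoCoalitionPartition {k} f =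
    (∀ i → ∃ λ v → f v ≡ i) ×
    (∀ i → (TwoDominating (block f i) × ∣ block f i ∣ ≡ 2)
           ⊎ (Σ (Fin k) λ j → j ≢ i × TwoCoalition (block f i) (block f j)))

  C₂≡ : ℕ → Set
  C₂≡ c =
    (Σ (Fin n → Fin c) IsTwoCoalitionPartition) ×
    (∀ k → (f : Fin n → Fin k) → IsTwoCoalitionPartition f → k ≤ c)

cycle : (n : ℕ) → 3 ≤ n → Graph n
cycle n h = record { Adj = cycleAdj n ; irrefl = irr ; sym = sy }
  where
  open import Data.Nat.Properties using (1+n≢n)
  open import Data.Sum using (inj₁; inj₂)
  open import Data.Product using (_,_)
  open import Relation.Binary.PropositionalEquality using (refl; trans; sym)
  open import Data.Empty using (⊥)
  irr : ∀ v → ¬ cycleAdj n v v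
  irr v (inj₁ e) = 1+n≢n (Relation.Binary.PropositionalEquality.sym e)
  irr v (inj₂ (inj₁ e)) = 1+n≢n (Relation.Binary.PropositionalEquality.sym e)
  irr v (inj₂ (inj₂ (inj₁ (a , b)))) = bad a b
    where
    bad : toℕ v ≡ 0 → suc (toℕ v) ≡ n → ⊥
    bad a b = lem h (trans (Relation.Binary.PropositionalEquality.sym b) (Relation.Binary.PropositionalEquality.cong suc a))
      where
      lem : ∀ {m} → 3 ≤ m → m ≡ 1 → ⊥
      lem (Data.Nat.s≤s ()) refl
  irr v (inj₂ (inj₂ (inj₂ (a , b)))) = irr v (inj₂ (inj₂ (inj₁ (a , b))))
  sy : ∀ u v → cycleAdj n u v → cycleAdj n v u
  sy u v (inj₁ e) = inj₂ (inj₁ e)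
  sy u v (inj₂ (inj₁ e)) = inj₁ e
  sy u v (inj₂ (inj₂ (inj₁ p))) = inj₂ (inj₂ (inj₂ p))
  sy u v (inj₂ (inj₂ (inj₂ p))) = inj₂ (inj₂ (inj₁ p))

-- In a graph where every vertex has exactly two neighbours, a set is 2-dominating iff it is a
-- vertex cover, and two disjoint vertex covers would properly 2-colour the graph, which an odd
-- cycle forbids. So in a 2-coalition partition no block covering on its own can coexist with
-- another block, and if {X, Y} is a coalition pair then every other block Z has its partner in
-- {X, Y}. Two further blocks Z, T either both partner the same member, say X, and then X alone
-- is a cover (an edge avoiding X cannot meet each of the disjoint Y, Z, T), or they partner
-- different members, giving two disjoint covers. Hence at most 3 blocks; three are attained by
-- {0}, the odd vertices, and the nonzero even vertices.
module Submission where

open import Defs hiding (sym)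
open import Level using (0ℓ)
open import Data.Nat using (ℕ; zero; suc; _+_; _≤_; _<_; _%_; z≤n; s≤s)
  renaming (_≟_ to _≟ℕ_)
open import Data.Nat.Properties using (≤∧≢⇒<; <⇒≢; <-trans; n<1+n; 1+n≢0; m≢1+n+m; suc-injective)
open import Data.Fin using (Fin; zero; suc; toℕ; fromℕ; fromℕ<; inject₁; #_; _≟_)
open import Data.Fin.Properties using (toℕ-injective; toℕ<n; toℕ-fromℕ; toℕ-fromℕ<; toℕ-inject₁)
open import Data.Fin.Subset using (_∈_)
import Data.Fin.Subset as Subset
open import Data.Fin.Subset.Properties using (_∈?_; ∪⇔⊎)
open import Data.Vec.Properties using (lookup∘tabulate; []=⇒lookup; lookup⇒[]=)
open import Data.Bool using (Bool; true; false; not; _xor_; if_then_else_)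
open import Data.Bool.Properties using (¬-not; not-distribˡ-xor; not-injective; not-involutive; T-≡)
open import Data.Empty using (⊥; ⊥-elim)
open import Data.Product using (Σ; ∃; _×_; _,_; proj₁)
import Data.Product as Product
open import Data.Sum using (_⊎_; inj₁; inj₂; [_,_])
import Data.Sum as Sum
open import Data.Sum.Function.Propositional using (_⊎-⇔_)
open import Function using (_∘_)
open import Function.Bundles using (_⇔_; mk⇔; Equivalence)
open import Function.Properties.Equivalence using () renaming (trans to ⇔-trans)
open import Relation.Nullary using (¬_; yes; no)
open import Relation.Nullary.Decidable using (isYes; toWitness; fromWitness)
open import Relation.Unary using (Pred; Decidable; _⊆_; _∪_; ｛_｝; _⊢_) renaming (_⊥_ to Disjoint)
open import Relation.Unary.Properties using (_∪?_)
open import Relation.Binary.PropositionalEquality using (_≡_; _≢_; refl; sym; trans; cong; subst; module ≡-Reasoning)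

open Equivalence using (to; from)

module _ {n : ℕ} (G : Graph n) where

  VertexCover : Pred (Fin n) 0ℓ → Set
  VertexCover P = ∀ u v → Adj G u v → P u ⊎ P v

  ProperTwoColouring : (Fin n → Bool) → Set
  ProperTwoColouring c = ∀ u v → Adj G u v → c u ≢ c v

  AtMostTwoNeighbours : Set
  AtMostTwoNeighbours = ∀ {u a b v} → a ≢ b → Adj G u a → Adj G u b → Adj G u v → v ≡ a ⊎ v ≡ b

  TwoNeighbours : Set
  TwoNeighbours = ∀ u → Σ (Fin n) λ a → Σ (Fin n) λ b → a ≢ b × Adj G u a × Adj G u b

  vertexCover-mono : {P Q : Pred (Fin n) 0ℓ} → P ⊆ Q → VertexCover P → VertexCover Q
  vertexCover-mono P⊆Q cover u v e = Sum.map P⊆Q P⊆Q (cover u v e)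

  twoDominating⇒vertexCover : AtMostTwoNeighbours → ∀ {S} → TwoDominating G S → VertexCover (_∈ S)
  twoDominating⇒vertexCover atMostTwo {S} dom u v e with u ∈? S
  ... | yes u∈S = inj₁ u∈S
  ... | no u∉S with dom u u∉S
  ...   | a , b , a≢b , a∈S , b∈S , ea , eb =
          inj₂ ([ (λ v≡a → subst (_∈ S) (sym v≡a) a∈S) , (λ v≡b → subst (_∈ S) (sym v≡b) b∈S) ]
                (atMostTwo a≢b ea eb e))

  vertexCover⇒twoDominating : TwoNeighbours → ∀ {S} → VertexCover (_∈ S) → TwoDominating G S
  vertexCover⇒twoDominating twoNbrs {S} cover u u∉S with twoNbrs u
  ... | a , b , a≢b , ea , eb = a , b , a≢b , neighbour∈S ea , neighbour∈S eb , ea , eb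
    where
    neighbour∈S : ∀ {w} → Adj G u w → w ∈ S
    neighbour∈S e = [ (λ u∈S → ⊥-elim (u∉S u∈S)) , (λ w∈S → w∈S) ] (cover u _ e)

  -- Each of A, B, C meets every edge outside P; three disjoint sets cannot share the two endpoints.
  vertexCover-cancel : {P A B C : Pred (Fin n) 0ℓ} → Disjoint A B → Disjoint A C → Disjoint B C →
    VertexCover (P ∪ A) → VertexCover (P ∪ B) → VertexCover (P ∪ C) → VertexCover P
  vertexCover-cancel {P} {A} {B} {C} A#B A#C B#C coverA coverB coverC u v e
    with split (coverA u v e) | split (coverB u v e) | split (coverC u v e)
    where
    split : ∀ {Q} → (P ∪ Q) u ⊎ (P ∪ Q) v → (P u ⊎ P v) ⊎ (Q u ⊎ Q v)
    split (inj₁ (inj₁ p)) = inj₁ (inj₁ p)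
    split (inj₁ (inj₂ q)) = inj₂ (inj₁ q)
    split (inj₂ (inj₁ p)) = inj₁ (inj₂ p)
    split (inj₂ (inj₂ q)) = inj₂ (inj₂ q)
  ... | inj₁ p | _      | _      = p
  ... | inj₂ _ | inj₁ p | _      = p
  ... | inj₂ _ | inj₂ _ | inj₁ p = p
  ... | inj₂ (inj₁ a) | inj₂ (inj₁ b) | inj₂ _        = ⊥-elim (A#B (a , b))
  ... | inj₂ (inj₂ a) | inj₂ (inj₂ b) | inj₂ _        = ⊥-elim (A#B (a , b))
  ... | inj₂ (inj₁ a) | inj₂ (inj₂ _) | inj₂ (inj₁ c) = ⊥-elim (A#C (a , c))
  ... | inj₂ (inj₂ a) | inj₂ (inj₁ _) | inj₂ (inj₂ c) = ⊥-elim (A#C (a , c))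
  ... | inj₂ (inj₁ _) | inj₂ (inj₂ b) | inj₂ (inj₂ c) = ⊥-elim (B#C (b , c))
  ... | inj₂ (inj₂ _) | inj₂ (inj₁ b) | inj₂ (inj₁ c) = ⊥-elim (B#C (b , c))

  disjointVertexCovers⇒proper : {P Q : Pred (Fin n) 0ℓ} (P? : Decidable P) → Disjoint P Q →
    VertexCover P → VertexCover Q → ProperTwoColouring (isYes ∘ P?)
  disjointVertexCovers⇒proper P? P#Q coverP coverQ u v e with P? u | P? v
  ... | yes _  | no _   = λ ()
  ... | no _   | yes _  = λ ()
  ... | yes pu | yes pv = λ _ → [ (λ qu → P#Q (pu , qu)) , (λ qv → P#Q (pv , qv)) ] (coverQ u v e)
  ... | no ¬pu | no ¬pv = λ _ → [ ¬pu , ¬pv ] (coverP u v e)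

module CoalitionPartition {n : ℕ} (G : Graph n) (atMostTwo : AtMostTwoNeighbours G) (twoNbrs : TwoNeighbours G)
                          {k : ℕ} (f : Fin n → Fin k) where

  Covers : Pred (Fin k) 0ℓ → Set
  Covers L = VertexCover G (f ⊢ L)

  Coalition : Fin k → Fin k → Set
  Coalition i j = ¬ Covers ｛ i ｝ × ¬ Covers ｛ j ｝ × Covers (｛ i ｝ ∪ ｛ j ｝)

  Role : Fin k → Set
  Role i = Covers ｛ i ｝ ⊎ Σ (Fin k) λ j → j ≢ i × Coalition i j

  covers-swap : ∀ {X Y} → Covers (｛ X ｝ ∪ ｛ Y ｝) → Covers (｛ Y ｝ ∪ ｛ X ｝)
  covers-swap = vertexCover-mono G Sum.swap

  twoDominating⇔vertexCover : ∀ {S P} → (∀ {v} → v ∈ S ⇔ P v) → TwoDominating G S ⇔ VertexCover G P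
  twoDominating⇔vertexCover S⇔P = mk⇔
    (vertexCover-mono G (to S⇔P) ∘ twoDominating⇒vertexCover G atMostTwo)
    (vertexCover⇒twoDominating G twoNbrs ∘ vertexCover-mono G (from S⇔P))

  ∈-block : ∀ {i v} → v ∈ block G f i ⇔ i ≡ f v
  ∈-block {i} {v} = mk⇔
    (λ v∈B → sym (toWitness (from T-≡ (trans (sym (lookup∘tabulate _ v)) ([]=⇒lookup v∈B)))))
    (λ i≡fv → lookup⇒[]= v _ (trans (lookup∘tabulate _ v) (to T-≡ (fromWitness (sym i≡fv)))))

  twoDominating-block⇔ : ∀ {i} → TwoDominating G (block G f i) ⇔ Covers ｛ i ｝
  twoDominating-block⇔ = twoDominating⇔vertexCover ∈-block

  twoDominating-block∪⇔ : ∀ {i j} →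
    TwoDominating G (block G f i Subset.∪ block G f j) ⇔ Covers (｛ i ｝ ∪ ｛ j ｝)
  twoDominating-block∪⇔ = twoDominating⇔vertexCover (⇔-trans ∪⇔⊎ (∈-block ⊎-⇔ ∈-block))

  twoCoalition⇒coalition : ∀ {i j} → TwoCoalition G (block G f i) (block G f j) → Coalition i j
  twoCoalition⇒coalition = Product.map (_∘ from twoDominating-block⇔)
                             (Product.map (_∘ from twoDominating-block⇔) (to twoDominating-block∪⇔))

  coalition⇒twoCoalition : ∀ {i j} → Coalition i j → TwoCoalition G (block G f i) (block G f j)
  coalition⇒twoCoalition = Product.map (_∘ to twoDominating-block⇔)
                             (Product.map (_∘ to twoDominating-block⇔) (from twoDominating-block∪⇔))

  partition⇒role : IsTwoCoalitionPartition G f → ∀ i → Role i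
  partition⇒role (_ , status) i =
    Sum.map (to twoDominating-block⇔ ∘ proj₁) (Product.map₂ (Product.map₂ twoCoalition⇒coalition)) (status i)

  covers-cancel : ∀ {X Y Z T} → Y ≢ Z → Y ≢ T → Z ≢ T →
    Covers (｛ X ｝ ∪ ｛ Y ｝) → Covers (｛ X ｝ ∪ ｛ Z ｝) → Covers (｛ X ｝ ∪ ｛ T ｝) → Covers ｛ X ｝
  covers-cancel Y≢Z Y≢T Z≢T = vertexCover-cancel G (apart Y≢Z) (apart Y≢T) (apart Z≢T)
    where
    apart : ∀ {A B} → A ≢ B → Disjoint (f ⊢ ｛ A ｝) (f ⊢ ｛ B ｝)
    apart A≢B (A≡fv , B≡fv) = A≢B (trans A≡fv (sym B≡fv))

  module _ (nonBipartite : ∀ c → ¬ ProperTwoColouring G c) where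

    disjointPairCovers : ∀ {X Y Z W} → X ≢ Z → X ≢ W → Y ≢ Z → Y ≢ W →
      Covers (｛ X ｝ ∪ ｛ Y ｝) → Covers (｛ Z ｝ ∪ ｛ W ｝) → ⊥
    disjointPairCovers {X} {Y} X≢Z X≢W Y≢Z Y≢W coverXY coverZW =
      nonBipartite _ (disjointVertexCovers⇒proper G (λ v → ((X ≟_) ∪? (Y ≟_)) (f v)) disjoint coverXY coverZW)
      where
      disjoint : Disjoint (f ⊢ (｛ X ｝ ∪ ｛ Y ｝)) (f ⊢ (｛ _ ｝ ∪ ｛ _ ｝))
      disjoint (inj₁ p , inj₁ q) = X≢Z (trans p (sym q))
      disjoint (inj₁ p , inj₂ q) = X≢W (trans p (sym q))
      disjoint (inj₂ p , inj₁ q) = Y≢Z (trans p (sym q))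
      disjoint (inj₂ p , inj₂ q) = Y≢W (trans p (sym q))

    coveringBlocks-distinct : ∀ {X Z} → X ≢ Z → Covers ｛ X ｝ → Covers ｛ Z ｝ → ⊥
    coveringBlocks-distinct X≢Z coverX coverZ =
      disjointPairCovers X≢Z X≢Z X≢Z X≢Z (vertexCover-mono G inj₁ coverX) (vertexCover-mono G inj₁ coverZ)

    coveringBlock-coalition : ∀ {Z X Y} → Covers ｛ Z ｝ → Coalition X Y → ⊥
    coveringBlock-coalition coverZ (¬coverX , ¬coverY , coverXY) =
      disjointPairCovers (differs ¬coverX) (differs ¬coverY) (differs ¬coverX) (differs ¬coverY)
        (vertexCover-mono G inj₁ coverZ) coverXY
      where
      differs : ∀ {X} → ¬ Covers ｛ X ｝ → _ ≢ X
      differs ¬coverX refl = ¬coverX coverZ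

    -- A coalition pair disjoint from {X, Y} would give two disjoint vertex covers.
    coalitionPartner : ∀ {X Y Z} → Coalition X Y → Z ≢ X → Z ≢ Y → Role Z →
      Covers (｛ X ｝ ∪ ｛ Z ｝) ⊎ Covers (｛ Y ｝ ∪ ｛ Z ｝)
    coalitionPartner coalitionXY Z≢X Z≢Y (inj₁ coverZ) = ⊥-elim (coveringBlock-coalition coverZ coalitionXY)
    coalitionPartner {X} {Y} (_ , _ , coverXY) Z≢X Z≢Y (inj₂ (W , _ , _ , _ , coverZW)) with W ≟ X | W ≟ Y
    ... | yes refl | _        = inj₁ (covers-swap coverZW)
    ... | no _     | yes refl = inj₂ (covers-swap coverZW)
    ... | no W≢X   | no W≢Y   =
          ⊥-elim (disjointPairCovers (Z≢X ∘ sym) (W≢X ∘ sym) (Z≢Y ∘ sym) (W≢Y ∘ sym) coverXY coverZW)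

    coalition-twoOthers : ∀ {X Y Z T} → Coalition X Y →
      X ≢ Y → X ≢ Z → X ≢ T → Y ≢ Z → Y ≢ T → Z ≢ T → Role Z → Role T → ⊥
    coalition-twoOthers coalitionXY@(¬coverX , ¬coverY , coverXY) X≢Y X≢Z X≢T Y≢Z Y≢T Z≢T roleZ roleT
      with coalitionPartner coalitionXY (X≢Z ∘ sym) (Y≢Z ∘ sym) roleZ
         | coalitionPartner coalitionXY (X≢T ∘ sym) (Y≢T ∘ sym) roleT
    ... | inj₁ coverXZ | inj₁ coverXT = ¬coverX (covers-cancel Y≢Z Y≢T Z≢T coverXY coverXZ coverXT)
    ... | inj₂ coverYZ | inj₂ coverYT = ¬coverY (covers-cancel X≢Z X≢T Z≢T (covers-swap coverXY) coverYZ coverYT)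
    ... | inj₁ coverXZ | inj₂ coverYT = disjointPairCovers X≢Y X≢T (Y≢Z ∘ sym) Z≢T coverXZ coverYT
    ... | inj₂ coverYZ | inj₁ coverXT = disjointPairCovers (X≢Y ∘ sym) Y≢T (X≢Z ∘ sym) Z≢T coverYZ coverXT

    fourLabels-absurd : (∀ i → Role i) → ∀ {l₀ l₁ l₂ l₃} →
      l₀ ≢ l₁ → l₀ ≢ l₂ → l₀ ≢ l₃ → l₁ ≢ l₂ → l₁ ≢ l₃ → l₂ ≢ l₃ → ⊥
    fourLabels-absurd role {l₀} {l₁} {l₂} {l₃} l₀≢l₁ l₀≢l₂ l₀≢l₃ l₁≢l₂ l₁≢l₃ l₂≢l₃ with role l₀
    ... | inj₁ cover₀ =
          [ coveringBlocks-distinct l₀≢l₁ cover₀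
          , (λ (_ , _ , coalition) → coveringBlock-coalition cover₀ coalition) ] (role l₁)
    ... | inj₂ (Y , Y≢l₀ , coalition) with Y ≟ l₁ | Y ≟ l₂
    ...   | yes refl | _        =
            coalition-twoOthers coalition (Y≢l₀ ∘ sym) l₀≢l₂ l₀≢l₃ l₁≢l₂ l₁≢l₃ l₂≢l₃ (role l₂) (role l₃)
    ...   | no Y≢l₁  | yes refl =
            coalition-twoOthers coalition (Y≢l₀ ∘ sym) l₀≢l₁ l₀≢l₃ Y≢l₁ l₂≢l₃ l₁≢l₃ (role l₁) (role l₃)
    ...   | no Y≢l₁  | no Y≢l₂  =
            coalition-twoOthers coalition (Y≢l₀ ∘ sym) l₀≢l₁ l₀≢l₂ Y≢l₁ Y≢l₂ l₁≢l₂ (role l₁) (role l₂)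

coalitionPartition-size≤3 : ∀ {n} (G : Graph n) → AtMostTwoNeighbours G → TwoNeighbours G →
  (∀ c → ¬ ProperTwoColouring G c) → ∀ k (f : Fin n → Fin k) → IsTwoCoalitionPartition G f → k ≤ 3
coalitionPartition-size≤3 G atMostTwo twoNbrs nonBipartite (suc (suc (suc (suc _)))) f partition =
  ⊥-elim (fourLabels-absurd nonBipartite (partition⇒role partition) {# 0} {# 1} {# 2} {# 3}
           (λ ()) (λ ()) (λ ()) (λ ()) (λ ()) (λ ()))
  where open CoalitionPartition G atMostTwo twoNbrs f
coalitionPartition-size≤3 _ _ _ _ 0 _ _ = z≤n
coalitionPartition-size≤3 _ _ _ _ 1 _ _ = s≤s z≤n
coalitionPartition-size≤3 _ _ _ _ 2 _ _ = s≤s (s≤s z≤n)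
coalitionPartition-size≤3 _ _ _ _ 3 _ _ = s≤s (s≤s (s≤s z≤n))

isOdd : ℕ → Bool
isOdd zero    = false
isOdd (suc m) = not (isOdd m)

-- (2 + m) % 2 reduces to m % 2, and 0 % 2 ≡ 1 is refuted by computation.
%2≡1⇒isOdd : ∀ m → m % 2 ≡ 1 → isOdd m ≡ true
%2≡1⇒isOdd (suc zero)    _  = refl
%2≡1⇒isOdd (suc (suc m)) eq = trans (not-involutive (isOdd m)) (%2≡1⇒isOdd m eq)

Succ : (n : ℕ) → Fin n → Fin n → Set
Succ n u v = toℕ v ≡ suc (toℕ u) ⊎ (toℕ v ≡ 0 × suc (toℕ u) ≡ n)

module _ {n : ℕ} where

  cycleAdj⇒Succ : ∀ {u v} → cycleAdj n u v → Succ n u v ⊎ Succ n v u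
  cycleAdj⇒Succ (inj₁ e)               = inj₁ (inj₁ e)
  cycleAdj⇒Succ (inj₂ (inj₁ e))        = inj₂ (inj₁ e)
  cycleAdj⇒Succ (inj₂ (inj₂ (inj₁ p))) = inj₂ (inj₂ p)
  cycleAdj⇒Succ (inj₂ (inj₂ (inj₂ p))) = inj₁ (inj₂ p)

  Succ⇒cycleAdj : ∀ {u v} → Succ n u v ⊎ Succ n v u → cycleAdj n u v
  Succ⇒cycleAdj (inj₁ (inj₁ e)) = inj₁ e
  Succ⇒cycleAdj (inj₁ (inj₂ p)) = inj₂ (inj₂ (inj₂ p))
  Succ⇒cycleAdj (inj₂ (inj₁ e)) = inj₂ (inj₁ e)
  Succ⇒cycleAdj (inj₂ (inj₂ p)) = inj₂ (inj₂ (inj₁ p))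

  Succ-functional : ∀ {u a b} → Succ n u a → Succ n u b → a ≡ b
  Succ-functional (inj₁ a≡) (inj₁ b≡)       = toℕ-injective (trans a≡ (sym b≡))
  Succ-functional {a = a} (inj₁ a≡) (inj₂ (_ , last)) = ⊥-elim (<⇒≢ (toℕ<n a) (trans a≡ last))
  Succ-functional {b = b} (inj₂ (_ , last)) (inj₁ b≡) = ⊥-elim (<⇒≢ (toℕ<n b) (trans b≡ last))
  Succ-functional (inj₂ (a≡0 , _)) (inj₂ (b≡0 , _)) = toℕ-injective (trans a≡0 (sym b≡0))

  Succ-injective : ∀ {u a b} → Succ n a u → Succ n b u → a ≡ b
  Succ-injective (inj₁ u≡) (inj₁ u≡′)           = toℕ-injective (suc-injective (trans (sym u≡) u≡′))
  Succ-injective (inj₁ u≡) (inj₂ (u≡0 , _))     = ⊥-elim (1+n≢0 (trans (sym u≡) u≡0))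
  Succ-injective (inj₂ (u≡0 , _)) (inj₁ u≡)     = ⊥-elim (1+n≢0 (trans (sym u≡) u≡0))
  Succ-injective (inj₂ (_ , last)) (inj₂ (_ , last′)) = toℕ-injective (suc-injective (trans last (sym last′)))

  cycle-atMostTwoNeighbours : ∀ h → AtMostTwoNeighbours (cycle n h)
  cycle-atMostTwoNeighbours _ a≢b ea eb ev with cycleAdj⇒Succ ea | cycleAdj⇒Succ eb | cycleAdj⇒Succ ev
  ... | inj₁ sa | _       | inj₁ sv = inj₁ (Succ-functional sv sa)
  ... | inj₂ sa | _       | inj₂ sv = inj₁ (Succ-injective sv sa)
  ... | inj₁ sa | inj₁ sb | inj₂ _  = ⊥-elim (a≢b (Succ-functional sa sb))
  ... | inj₂ sa | inj₂ sb | inj₁ _  = ⊥-elim (a≢b (Succ-injective sa sb))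
  ... | inj₁ _  | inj₂ sb | inj₂ sv = inj₂ (Succ-injective sv sb)
  ... | inj₂ _  | inj₁ sb | inj₁ sv = inj₂ (Succ-functional sv sb)

  cycle-vertexCover : ∀ h {P} → (∀ {u v} → Succ n u v → P u ⊎ P v) → VertexCover (cycle n h) P
  cycle-vertexCover _ cover u v e = [ cover , Sum.swap ∘ cover ] (cycleAdj⇒Succ e)

succ-exists : ∀ {n} (u : Fin n) → ∃ (Succ n u)
succ-exists {suc m} u with suc (toℕ u) ≟ℕ suc m
... | yes last = zero , inj₂ (refl , last)
... | no ¬last = fromℕ< u+1<n , inj₁ (toℕ-fromℕ< u+1<n)
  where
  u+1<n : suc (toℕ u) < suc m
  u+1<n = ≤∧≢⇒< (toℕ<n u) ¬last

pred-exists : ∀ {n} (u : Fin n) → ∃ λ a → Succ n a u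
pred-exists {suc m} zero = fromℕ m , inj₂ (refl , cong suc (toℕ-fromℕ m))
pred-exists (suc t) = inject₁ t , inj₁ (cong suc (sym (toℕ-inject₁ t)))

oddCycle-notBipartite : ∀ {n} h → isOdd n ≡ true → ∀ c → ¬ ProperTwoColouring (cycle n h) c
oddCycle-notBipartite {suc m} _ odd c proper = proper last zero (Succ⇒cycleAdj (inj₁ last→0)) sameColour
  where
  open ≡-Reasoning
  last : Fin (suc m)
  last = fromℕ< (n<1+n m)
  last→0 : Succ (suc m) last zero
  last→0 = inj₂ (refl , cong suc (toℕ-fromℕ< _))
  alternates : ∀ t (t<n : t < suc m) → c (fromℕ< t<n) ≡ isOdd t xor c zero
  alternates zero    _      = refl
  alternates (suc t) t+1<n = begin
    c (fromℕ< t+1<n)          ≡⟨ ¬-not (proper _ _ (Succ⇒cycleAdj (inj₂ step))) ⟩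
    not (c (fromℕ< t<n))      ≡⟨ cong not (alternates t t<n) ⟩
    not (isOdd t xor c zero)  ≡⟨ not-distribˡ-xor (isOdd t) (c zero) ⟩
    isOdd (suc t) xor c zero  ∎
    where
    t<n : t < suc m
    t<n = <-trans (n<1+n t) t+1<n
    step : Succ (suc m) (fromℕ< t<n) (fromℕ< t+1<n)
    step = inj₁ (trans (toℕ-fromℕ< t+1<n) (cong suc (sym (toℕ-fromℕ< t<n))))
  sameColour : c last ≡ c zero
  sameColour = trans (alternates m (n<1+n m)) (cong (_xor c zero) (not-injective odd))

succ≢pred : ∀ {k u a b} → Succ (3 + k) u a → Succ (3 + k) b u → a ≢ b
succ≢pred {a = a} (inj₁ a≡) (inj₁ u≡) refl = m≢1+n+m (toℕ a) (trans a≡ (cong suc u≡))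
succ≢pred (inj₁ a≡) (inj₂ (u≡0 , last)) refl with trans (sym last) (cong suc (trans a≡ (cong suc u≡0)))
... | ()
succ≢pred (inj₂ (a≡0 , last)) (inj₁ u≡) refl with trans (sym last) (cong suc (trans u≡ (cong suc a≡0)))
... | ()
succ≢pred (inj₂ (_ , last)) (inj₂ (u≡0 , _)) refl with trans (sym last) (cong suc u≡0)
... | ()

cycle-twoNeighbours : ∀ k h → TwoNeighbours (cycle (3 + k) h)
cycle-twoNeighbours k _ u with succ-exists u | pred-exists u
... | a , u→a | b , b→u = a , b , succ≢pred u→a b→u , Succ⇒cycleAdj (inj₁ u→a) , Succ⇒cycleAdj (inj₂ b→u)

labelℕ : ℕ → Fin 3
labelℕ zero    = # 0
labelℕ (suc m) = if isOdd (suc m) then # 1 else # 2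

label : ∀ {n} → Fin n → Fin 3
label = labelℕ ∘ toℕ

labelℕ-suc-odd : ∀ m → isOdd m ≡ true → labelℕ (suc m) ≡ # 2
labelℕ-suc-odd m odd rewrite odd = refl

labelℕ-even : ∀ m → isOdd m ≡ false → (｛ # 0 ｝ ∪ ｛ # 2 ｝) (labelℕ m)
labelℕ-even zero    _    = inj₁ refl
labelℕ-even (suc m) even = inj₂ (sym (labelℕ-suc-odd m (not-injective even)))

labelℕ-positive : ∀ m → (｛ # 1 ｝ ∪ ｛ # 2 ｝) (labelℕ (suc m))
labelℕ-positive m with isOdd (suc m)
... | true  = inj₁ refl
... | false = inj₂ refl

module _ (k : ℕ) (h : 3 ≤ 3 + k) (odd : isOdd (3 + k) ≡ true) where

  open CoalitionPartition (cycle (3 + k) h) (cycle-atMostTwoNeighbours h) (cycle-twoNeighbours k h) label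

  even-cover : Covers (｛ # 0 ｝ ∪ ｛ # 2 ｝)
  even-cover = cycle-vertexCover h cover
    where
    cover : ∀ {u v} → Succ (3 + k) u v → (｛ # 0 ｝ ∪ ｛ # 2 ｝) (label u) ⊎ (｛ # 0 ｝ ∪ ｛ # 2 ｝) (label v)
    cover {u} (inj₁ v≡) with isOdd (toℕ u) in parity
    ... | false = inj₁ (labelℕ-even (toℕ u) parity)
    ... | true  =
      inj₂ (subst ((｛ # 0 ｝ ∪ ｛ # 2 ｝) ∘ labelℕ) (sym v≡) (labelℕ-even (suc (toℕ u)) (cong not parity)))
    cover (inj₂ (v≡0 , _)) = inj₂ (subst ((｛ # 0 ｝ ∪ ｛ # 2 ｝) ∘ labelℕ) (sym v≡0) (inj₁ refl))

  positive-cover : Covers (｛ # 1 ｝ ∪ ｛ # 2 ｝)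
  positive-cover = cycle-vertexCover h cover
    where
    cover : ∀ {u v} → Succ (3 + k) u v → (｛ # 1 ｝ ∪ ｛ # 2 ｝) (label u) ⊎ (｛ # 1 ｝ ∪ ｛ # 2 ｝) (label v)
    cover {u} (inj₁ v≡)     = inj₂ (subst ((｛ # 1 ｝ ∪ ｛ # 2 ｝) ∘ labelℕ) (sym v≡) (labelℕ-positive (toℕ u)))
    cover (inj₂ (_ , last)) =
      inj₁ (subst ((｛ # 1 ｝ ∪ ｛ # 2 ｝) ∘ labelℕ) (sym (suc-injective last)) (labelℕ-positive (1 + k)))

  ¬cover₀ : ¬ Covers ｛ # 0 ｝
  ¬cover₀ cover = [ (λ ()) , (λ ()) ] (cover (# 1) (# 2) (inj₁ refl))

  ¬cover₂ : ¬ Covers ｛ # 2 ｝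
  ¬cover₂ cover = [ (λ ()) , (λ ()) ] (cover (# 0) (# 1) (inj₁ refl))

  ¬cover₁ : ¬ Covers ｛ # 1 ｝
  ¬cover₁ cover with cover (fromℕ (2 + k)) (# 0) (Succ⇒cycleAdj (inj₁ (inj₂ (refl , cong suc (toℕ-fromℕ (2 + k))))))
  ... | inj₂ ()
  ... | inj₁ 1≡label-last with trans 1≡label-last (trans (cong labelℕ (toℕ-fromℕ (2 + k))) label-last≡2)
    where
    label-last≡2 : labelℕ (2 + k) ≡ # 2
    label-last≡2 = labelℕ-suc-odd (1 + k) (trans (sym (not-involutive (isOdd (1 + k)))) odd)
  ...   | ()

  oddCycle-coalitionPartition : IsTwoCoalitionPartition (cycle (3 + k) h) label
  oddCycle-coalitionPartition =
      (λ { zero → # 0 , refl ; (suc zero) → # 1 , refl ; (suc (suc zero)) → # 2 , refl })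
    , λ { zero             → inj₂ (# 2 , (λ ()) , coalition⇒twoCoalition (¬cover₀ , ¬cover₂ , even-cover))
        ; (suc zero)       → inj₂ (# 2 , (λ ()) , coalition⇒twoCoalition (¬cover₁ , ¬cover₂ , positive-cover))
        ; (suc (suc zero)) → inj₂ (# 0 , (λ ()) , coalition⇒twoCoalition (¬cover₂ , ¬cover₀ , covers-swap even-cover)) }

lemma3 : (n : ℕ) → (h : 3 ≤ n) → n % 2 ≡ 1 → C₂≡ (cycle n h) 3
lemma3 zero                () _
lemma3 (suc zero)          (s≤s ()) _
lemma3 (suc (suc zero))    (s≤s (s≤s ())) _
lemma3 (suc (suc (suc k))) h odd =
    (label , oddCycle-coalitionPartition k h isOdd-n)
  , coalitionPartition-size≤3 (cycle _ h) (cycle-atMostTwoNeighbours h) (cycle-twoNeighbours k h)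
      (oddCycle-notBipartite h isOdd-n)
  where
  isOdd-n : isOdd (3 + k) ≡ true
  isOdd-n = %2≡1⇒isOdd (3 + k) odd
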